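{- Let $k\geq 1$ and let $m,n$ be distinct odd positive integers with $m,n\leq k$. Then every vertex of $\widetilde\Omega_{2k}$ of weight $(m,2k-m)$ has a different number of neighbors of weight $(k-1,k+1)$ than every vertex of $\widetilde\Omega_{2k}$ of weight $(n,2k-n)$.
   Context: The orthogonality graph $\Omega_{2k}$ has vertex set $\mathbb{Z}_2^{2k}$ (bitstrings of length $2k$), with two vertices adjacent if and only if they differ in exactly $k$ positions. $\mathbf{1}$ is the all-ones bitstring, $+$ is bitwise addition mod 2, and $\mathrm{wt}(\mathbf{x})$ is the number of 1s in $\mathbf{x}$. The quotient graph $\widetilde\Omega_{2k}$ has vertices $[\mathbf{u}]=\{\mathbf{u},\mathbf{u}+\mathbf{1}\}$, with $[\mathbf{u}]$ adjacent to $[\mathbf{x}]$ iff some element of $[\mathbf{u}]$ is adjacent in $\Omega_{2k}$ to some element of $[\mathbf{x}]$. The weight of $[\mathbf{x}]$ is $(\mathrm{wt}(\mathbf{x}),2k-\mathrm{wt}(\mathbf{x}))$, with the representative chosen so that $\mathrm{wt}(\mathbf{x})\leq k$. -}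

module Defs where

open import Data.Bool using (Bool; true; false; not; _∧_; _∨_; _xor_)
open import Data.Nat using (ℕ; zero; suc; _+_; _*_; _∸_; _⊓_; _≡ᵇ_; _<ᵇ_)
open import Data.Vec using (Vec; []; _∷_; zipWith; map; replicate)
open import Data.List using (List; filter; length; concatMap) renaming ([] to []ᴸ; _∷_ to _∷ᴸ_; map to mapᴸ)
open import Data.Product using (∃)
open import Relation.Binary.PropositionalEquality using (_≡_)
open import Relation.Nullary.Decidable using (yes; no)
open import Data.Bool.Properties using (T?)
open import Data.Bool using (T)

Odd : ℕ → Set
Odd m = ∃ λ j → m ≡ suc (2 * j)

Bits : ℕ → Set
Bits n = Vec Bool n

wt : ∀ {n} → Bits n → ℕ
wt [] = 0
wt (true ∷ xs) = suc (wt xs)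
wt (false ∷ xs) = wt xs

_⊕_ : ∀ {n} → Bits n → Bits n → Bits n
_⊕_ = zipWith _xor_

𝟏 : ∀ {n} → Bits n
𝟏 = replicate _ true

dist : ∀ {n} → Bits n → Bits n → ℕ
dist x y = wt (x ⊕ y)

adjΩ : (k : ℕ) → Bits (2 * k) → Bits (2 * k) → Bool
adjΩ k x y = dist x y ≡ᵇ k

-- adjacency in the quotient graph: some element of [u] adjacent to some element of [x]
adjQ : (k : ℕ) → Bits (2 * k) → Bits (2 * k) → Bool
adjQ k u x = adjΩ k u x ∨ adjΩ k u (x ⊕ 𝟏) ∨ adjΩ k (u ⊕ 𝟏) x ∨ adjΩ k (u ⊕ 𝟏) (x ⊕ 𝟏)

-- the weight (w, 2k - w) of the class [x] is recorded by its first component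
-- w = min(wt x, 2k - wt x)
classWt : (k : ℕ) → Bits (2 * k) → ℕ
classWt k x = wt x ⊓ (2 * k ∸ wt x)

allBits : (n : ℕ) → List (Bits n)
allBits zero = [] ∷ᴸ []ᴸ
allBits (suc n) = concatMap (λ xs → (false ∷ xs) ∷ᴸ (true ∷ xs) ∷ᴸ []ᴸ) (allBits n)

firstBitFalse : ∀ {n} → Bits n → Bool
firstBitFalse [] = true
firstBitFalse (b ∷ _) = not b

-- canonical representative of its class {x, x + 1}: exactly one element of
-- each class is canonical (weight < k, or weight k with first bit 0)
canonical : (k : ℕ) → Bits (2 * k) → Bool
canonical k x = (wt x <ᵇ k) ∨ ((wt x ≡ᵇ k) ∧ firstBitFalse x)

-- number of neighbours of [u] in the quotient graph having weight (w, 2k - w),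
-- counting each class once via its canonical representative
nbrsOfWt : (k : ℕ) → Bits (2 * k) → ℕ → ℕ
nbrsOfWt k u w =
  length (filter (λ x → T? (canonical k x ∧ (classWt k x ≡ᵇ w) ∧ adjQ k u x)) (allBits (2 * k)))

module Submission where

-- Write k = s + 1.  Complementing one endpoint turns a distance d into 2k - d, so [u] and [x] are
-- adjacent iff d(u, x) = k, and a class of weight (s, s + 2) has exactly one representative x of
-- weight s.  Choose the representative u of the first class with wt u = 2j + 1, and let j + t = s.
-- If a = |u ∧ x| and b = |ū ∧ x|, the conditions wt x = s and d(u, x) = s + 1 force a = j and
-- b = t, so the neighbour count is C(2j+1, j) · C(2t+1, t).  For h(j) = C(2j+1, j) one has
-- (j + 2) h(j + 1) = 2 (2j + 3) h(j), so h(j + 1) / h(j) is strictly increasing and h(j) h(s - j)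
-- strictly decreases as j grows towards s / 2: distinct odd weights m, n ≤ k give distinct counts.

open import Defs
open import Data.Bool using (Bool; true; false; _∧_; _xor_; T)
open import Data.Bool.Properties
  using (T?; T-∧; T-∨; ∧-zeroʳ; ∧-comm; xor-assoc; xor-comm; xor-identityʳ)
open import Data.Nat
open import Data.Nat.Properties
open import Data.Nat.Combinatorics using (_C_; nCk≡nC[n∸k]; nC1≡n; nCk+nC[k+1]≡[n+1]C[k+1])
open import Data.Nat.Tactic.RingSolver using (solve-∀)
open import Data.Vec using ([]; _∷_; replicate; zipWith)
open import Data.Vec.Properties using (zipWith-assoc; zipWith-comm; zipWith-identityʳ; zipWith-replicate)
open import Data.List using (List; filter; length; concatMap) renaming ([] to []ᴸ; _∷_ to _∷ᴸ_)
open import Data.List.Properties using (filter-≐)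
open import Data.Product using (_,_; _×_; proj₁)
open import Data.Sum using (_⊎_; inj₁; inj₂; [_,_]′)
import Data.Sum as Sum
open import Function using (_∘_; _⇔_; mk⇔; Equivalence)
open import Relation.Binary.Definitions using (tri<; tri≈; tri>)
open import Relation.Binary.PropositionalEquality
open import Relation.Nullary using (contradiction)

open Equivalence using (to; from)

C-sym : ∀ a b {n} → n ≡ a + b → n C a ≡ n C b
C-sym a b refl = trans (nCk≡nC[n∸k] (m≤m+n a b)) (cong ((a + b) C_) (m+n∸m≡n a b))

0<nCk : ∀ {n k} → k ≤ n → 0 < n C k
0<nCk {n}     {zero}  _         = z<s
0<nCk {suc n} {suc k} (s≤s k≤n) =
  subst (0 <_) (nCk+nC[k+1]≡[n+1]C[k+1] n k) (<-≤-trans (0<nCk k≤n) (m≤m+n _ _))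

[k+1]*[n+1]C[k+1]≡[n+1]*nCk : ∀ n k → suc k * (suc n C suc k) ≡ suc n * (n C k)
[k+1]*[n+1]C[k+1]≡[n+1]*nCk zero    zero    = refl
[k+1]*[n+1]C[k+1]≡[n+1]*nCk zero    (suc k) = *-zeroʳ (suc (suc k))
[k+1]*[n+1]C[k+1]≡[n+1]*nCk (suc n) zero    =
  trans (*-identityˡ _) (trans (nC1≡n (suc (suc n))) (sym (*-identityʳ _)))
[k+1]*[n+1]C[k+1]≡[n+1]*nCk (suc n) (suc k) = begin
  suc (suc k) * (suc (suc n) C suc (suc k))
    ≡⟨ cong (suc (suc k) *_) (nCk+nC[k+1]≡[n+1]C[k+1] (suc n) (suc k)) ⟨
  suc (suc k) * (P + Q)
    ≡⟨ regroup k P Q ⟩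
  P + (suc k * P + suc (suc k) * Q)
    ≡⟨ cong₂ (λ a b → P + (a + b)) ([k+1]*[n+1]C[k+1]≡[n+1]*nCk n k)
                                   ([k+1]*[n+1]C[k+1]≡[n+1]*nCk n (suc k)) ⟩
  P + (suc n * (n C k) + suc n * (n C suc k))
    ≡⟨ cong (P +_) (*-distribˡ-+ (suc n) (n C k) (n C suc k)) ⟨
  P + suc n * (n C k + n C suc k)
    ≡⟨ cong (λ c → P + suc n * c) (nCk+nC[k+1]≡[n+1]C[k+1] n k) ⟩
  suc (suc n) * P ∎
  where
  open ≡-Reasoning
  P = suc n C suc k
  Q = suc n C suc (suc k)
  regroup : ∀ k P Q → suc (suc k) * (P + Q) ≡ P + (suc k * P + suc (suc k) * Q)
  regroup = solve-∀

StrictlyLogConvex : (ℕ → ℕ) → Set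
StrictlyLogConvex f = ∀ {i t} → i < t → f (suc i) * f t < f i * f (suc t)

product-decreasing : ∀ {f} → StrictlyLogConvex f → ∀ {j₁ t₁ j₂ t₂} →
  j₁ < j₂ → j₂ ≤ t₂ → j₁ + t₁ ≡ j₂ + t₂ → f j₂ * f t₂ < f j₁ * f t₁
product-decreasing {f} convex {j₁} {t₁} {suc i} {t₂} j₁<j₂ j₂≤t₂ sums
  with m<1+n⇒m<n∨m≡n j₁<j₂
... | inj₂ refl = subst (λ t → f (suc i) * f t₂ < f i * f t) (sym t₁≡1+t₂) step
  where
  t₁≡1+t₂ : t₁ ≡ suc t₂
  t₁≡1+t₂ = +-cancelˡ-≡ i t₁ (suc t₂) (trans sums (sym (+-suc i t₂)))
  step : f (suc i) * f t₂ < f i * f (suc t₂)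
  step = convex j₂≤t₂
... | inj₁ j₁<i = <-trans (convex j₂≤t₂)
  (product-decreasing {f} convex j₁<i (m≤n⇒m≤1+n (<⇒≤ j₂≤t₂)) (trans sums (sym (+-suc i t₂))))

oddCentral : ℕ → ℕ
oddCentral j = suc (2 * j) C j

oddCentral-pos : ∀ j → 0 < oddCentral j
oddCentral-pos j = 0<nCk (≤-trans (m≤m+n j (j + 0)) (n≤1+n _))

oddCentral-suc : ∀ j → suc (suc j) * oddCentral (suc j) ≡ 2 * suc (2 * suc j) * oddCentral j
oddCentral-suc j = begin
  suc (suc j) * (suc (2 * suc j) C suc j)
    ≡⟨ cong (suc (suc j) *_) (C-sym (suc j) (suc (suc j)) (split j)) ⟩
  suc (suc j) * (suc (2 * suc j) C suc (suc j))
    ≡⟨ [k+1]*[n+1]C[k+1]≡[n+1]*nCk (2 * suc j) (suc j) ⟩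
  suc (2 * suc j) * (2 * suc j C suc j)
    ≡⟨ cong (λ n → suc (2 * suc j) * (n C suc j)) (double-suc j) ⟩
  suc (2 * suc j) * (suc (suc (2 * j)) C suc j)
    ≡⟨ cong (suc (2 * suc j) *_) (nCk+nC[k+1]≡[n+1]C[k+1] (suc (2 * j)) j) ⟨
  suc (2 * suc j) * (oddCentral j + suc (2 * j) C suc j)
    ≡⟨ cong (λ c → suc (2 * suc j) * (oddCentral j + c)) (C-sym (suc j) j (split′ j)) ⟩
  suc (2 * suc j) * (oddCentral j + oddCentral j)
    ≡⟨ double (suc (2 * suc j)) (oddCentral j) ⟩
  2 * suc (2 * suc j) * oddCentral j ∎
  where
  open ≡-Reasoning
  split : ∀ j → suc (2 * suc j) ≡ suc j + suc (suc j)
  split = solve-∀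
  split′ : ∀ j → suc (2 * j) ≡ suc j + j
  split′ = solve-∀
  double-suc : ∀ j → 2 * suc j ≡ suc (suc (2 * j))
  double-suc = solve-∀
  double : ∀ a c → a * (c + c) ≡ 2 * a * c
  double = solve-∀

oddCentral-strictlyLogConvex : StrictlyLogConvex oddCentral
oddCentral-strictlyLogConvex {i} {t} i<t = *-cancelˡ-< K _ _ (begin-strict
  K * (h (suc i) * h t)
    ≡⟨ interchange (suc (suc i)) (suc (suc t)) (h (suc i)) (h t) ⟩
  (suc (suc i) * h (suc i)) * (suc (suc t) * h t)
    ≡⟨ cong (_* (suc (suc t) * h t)) (oddCentral-suc i) ⟩
  (2 * A * h i) * (suc (suc t) * h t)
    ≡⟨ collect A (suc (suc t)) (h i) (h t) ⟩
  P * (2 * (A * suc (suc t)))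
    <⟨ *-monoʳ-< P {{P≢0}} (*-monoʳ-< 2 (cross-< i<t)) ⟩
  P * (2 * (B * suc (suc i)))
    ≡⟨ collect′ B (suc (suc i)) (h i) (h t) ⟨
  (suc (suc i) * h i) * (2 * B * h t)
    ≡⟨ cong ((suc (suc i) * h i) *_) (oddCentral-suc t) ⟨
  (suc (suc i) * h i) * (suc (suc t) * h (suc t))
    ≡⟨ interchange (suc (suc i)) (suc (suc t)) (h i) (h (suc t)) ⟨
  K * (h i * h (suc t)) ∎)
  where
  open ≤-Reasoning
  h = oddCentral
  K = suc (suc i) * suc (suc t)
  A = suc (2 * suc i)
  B = suc (2 * suc t)
  P = h i * h t
  P≢0 : NonZero P
  P≢0 = m*n≢0 (h i) (h t) {{>-nonZero (oddCentral-pos i)}} {{>-nonZero (oddCentral-pos t)}}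
  interchange : ∀ a b x y → (a * b) * (x * y) ≡ (a * x) * (b * y)
  interchange = solve-∀
  collect : ∀ a b x y → (2 * a * x) * (b * y) ≡ (x * y) * (2 * (a * b))
  collect = solve-∀
  collect′ : ∀ a b x y → (b * x) * (2 * a * y) ≡ (x * y) * (2 * (a * b))
  collect′ = solve-∀
  cross-< : ∀ {i t} → i < t → suc (2 * suc i) * suc (suc t) < suc (2 * suc t) * suc (suc i)
  cross-< {i} i<t with m≤n⇒∃[o]m+o≡n i<t
  ... | e , refl = subst (suc (2 * suc i) * suc (suc (suc i + e)) <_) (sym (excess i e)) (m<m+n _ z<s)
    where
    excess : ∀ i e → suc (2 * suc (suc i + e)) * suc (suc i)
                   ≡ suc (2 * suc i) * suc (suc (suc i + e)) + suc e
    excess = solve-∀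

2*j≤s⇒j≤s : ∀ {j s} → 2 * j ≤ s → j ≤ s
2*j≤s⇒j≤s {j} 2j≤s = ≤-trans (m≤m+n j (j + 0)) 2j≤s

2*j≤s⇒j≤s∸j : ∀ {j s} → 2 * j ≤ s → j ≤ s ∸ j
2*j≤s⇒j≤s∸j {j} {s} 2j≤s = m+n≤o⇒m≤o∸n j (subst (_≤ s) (cong (j +_) (+-identityʳ j)) 2j≤s)

oddCentral-balanced-decreasing : ∀ {s j₁ j₂} → j₁ < j₂ → 2 * j₂ ≤ s →
  oddCentral j₂ * oddCentral (s ∸ j₂) < oddCentral j₁ * oddCentral (s ∸ j₁)
oddCentral-balanced-decreasing j₁<j₂ 2j₂≤s =
  product-decreasing {oddCentral} oddCentral-strictlyLogConvex j₁<j₂ (2*j≤s⇒j≤s∸j 2j₂≤s)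
    (trans (m+[n∸m]≡n (≤-trans (<⇒≤ j₁<j₂) j₂≤s)) (sym (m+[n∸m]≡n j₂≤s)))
  where j₂≤s = 2*j≤s⇒j≤s 2j₂≤s

oddCentral-balanced-injective : ∀ {s j₁ j₂} → 2 * j₁ ≤ s → 2 * j₂ ≤ s →
  oddCentral j₁ * oddCentral (s ∸ j₁) ≡ oddCentral j₂ * oddCentral (s ∸ j₂) → j₁ ≡ j₂
oddCentral-balanced-injective {j₁ = j₁} {j₂} 2j₁≤s 2j₂≤s same with <-cmp j₁ j₂
... | tri< j₁<j₂ _ _ = contradiction (sym same) (<⇒≢ (oddCentral-balanced-decreasing j₁<j₂ 2j₂≤s))
... | tri≈ _ j₁≡j₂ _ = j₁≡j₂
... | tri> _ _ j₂<j₁ = contradiction same (<⇒≢ (oddCentral-balanced-decreasing j₂<j₁ 2j₁≤s))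

⊕-complementʳ : ∀ {n} (u x : Bits n) → u ⊕ (x ⊕ 𝟏) ≡ (u ⊕ x) ⊕ 𝟏
⊕-complementʳ u x = sym (zipWith-assoc xor-assoc u x 𝟏)

⊕-complementˡ : ∀ {n} (u x : Bits n) → (u ⊕ 𝟏) ⊕ x ≡ u ⊕ (x ⊕ 𝟏)
⊕-complementˡ u x = trans (zipWith-assoc xor-assoc u 𝟏 x) (cong (u ⊕_) (zipWith-comm xor-comm 𝟏 x))

complement-involutive : ∀ {n} (v : Bits n) → (v ⊕ 𝟏) ⊕ 𝟏 ≡ v
complement-involutive v = begin
  (v ⊕ 𝟏) ⊕ 𝟏           ≡⟨ zipWith-assoc xor-assoc v 𝟏 𝟏 ⟩
  v ⊕ (𝟏 ⊕ 𝟏)           ≡⟨ cong (v ⊕_) (zipWith-replicate _xor_ true true) ⟩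
  v ⊕ replicate _ false ≡⟨ zipWith-identityʳ xor-identityʳ v ⟩
  v                     ∎
  where open ≡-Reasoning

wt-complement : ∀ {n} (v : Bits n) → wt (v ⊕ 𝟏) + wt v ≡ n
wt-complement []          = refl
wt-complement (true ∷ v)  = trans (+-suc (wt (v ⊕ 𝟏)) (wt v)) (cong suc (wt-complement v))
wt-complement (false ∷ v) = cong suc (wt-complement v)

wt-complement-∸ : ∀ {n} (v : Bits n) → wt (v ⊕ 𝟏) ≡ n ∸ wt v
wt-complement-∸ v = trans (sym (m+n∸n≡m (wt (v ⊕ 𝟏)) (wt v))) (cong (_∸ wt v) (wt-complement v))

dist-complementʳ : ∀ {n} (u x : Bits n) → dist u (x ⊕ 𝟏) + dist u x ≡ n
dist-complementʳ u x = trans (cong (λ v → wt v + dist u x) (⊕-complementʳ u x)) (wt-complement (u ⊕ x))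

dist-complementˡ : ∀ {n} (u x : Bits n) → dist (u ⊕ 𝟏) x ≡ dist u (x ⊕ 𝟏)
dist-complementˡ u x = cong wt (⊕-complementˡ u x)

dist-complement-both : ∀ {n} (u x : Bits n) → dist (u ⊕ 𝟏) (x ⊕ 𝟏) ≡ dist u x
dist-complement-both u x = cong wt (trans (⊕-complementˡ u (x ⊕ 𝟏)) (cong (u ⊕_) (complement-involutive x)))

common : ∀ {n} → Bits n → Bits n → ℕ
common u x = wt (zipWith _∧_ u x)

common-comm : ∀ {n} (u x : Bits n) → common u x ≡ common x u
common-comm u x = cong wt (zipWith-comm ∧-comm u x)

wt-common : ∀ {n} (u x : Bits n) → wt x ≡ common u x + common (u ⊕ 𝟏) x
wt-common []          []          = refl
wt-common (true ∷ u)  (true ∷ x)  = cong suc (wt-common u x)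
wt-common (true ∷ u)  (false ∷ x) = wt-common u x
wt-common (false ∷ u) (true ∷ x)  = trans (cong suc (wt-common u x)) (sym (+-suc _ _))
wt-common (false ∷ u) (false ∷ x) = wt-common u x

dist-common : ∀ {n} (u x : Bits n) → dist u x ≡ common u (x ⊕ 𝟏) + common (u ⊕ 𝟏) x
dist-common []          []          = refl
dist-common (true ∷ u)  (true ∷ x)  = dist-common u x
dist-common (true ∷ u)  (false ∷ x) = cong suc (dist-common u x)
dist-common (false ∷ u) (true ∷ x)  = trans (cong suc (dist-common u x)) (sym (+-suc _ _))
dist-common (false ∷ u) (false ∷ x) = dist-common u x

countᵇ : ∀ {A : Set} → (A → Bool) → List A → ℕ
countᵇ p xs = length (filter (λ x → T? (p x)) xs)

countᵇ-cong : ∀ {A : Set} {p q : A → Bool} → (∀ x → T (p x) ⇔ T (q x)) → ∀ xs → countᵇ p xs ≡ countᵇ q xs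
countᵇ-cong {p = p} {q} p⇔q xs =
  cong length (filter-≐ (λ x → T? (p x)) (λ x → T? (q x)) ((λ {x} → to (p⇔q x)) , (λ {x} → from (p⇔q x))) xs)

countᵇ-none : ∀ {A : Set} {p : A → Bool} → (∀ x → p x ≡ false) → ∀ xs → countᵇ p xs ≡ 0
countᵇ-none p≡false []ᴸ       = refl
countᵇ-none p≡false (x ∷ᴸ xs) rewrite p≡false x = countᵇ-none p≡false xs

countᵇ-allBits-suc : ∀ {n} (p : Bits (suc n) → Bool) →
  countᵇ p (allBits (suc n)) ≡ countᵇ (p ∘ (false ∷_)) (allBits n) + countᵇ (p ∘ (true ∷_)) (allBits n)
countᵇ-allBits-suc p = go (allBits _)
  where
  go : ∀ l → countᵇ p (concatMap (λ xs → (false ∷ xs) ∷ᴸ (true ∷ xs) ∷ᴸ []ᴸ) l)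
           ≡ countᵇ (p ∘ (false ∷_)) l + countᵇ (p ∘ (true ∷_)) l
  go []ᴸ = refl
  -- p (true ∷ x) only appears in the goal once filter has consumed false ∷ x, hence the nested withs.
  go (x ∷ᴸ l) with p (false ∷ x)
  ... | true  with p (true ∷ x)
  ...   | true  = cong suc (trans (cong suc (go l)) (sym (+-suc _ _)))
  ...   | false = cong suc (go l)
  go (x ∷ᴸ l) | false with p (true ∷ x)
  ...   | true  = trans (cong suc (go l)) (sym (+-suc _ _))
  ...   | false = go l

meets : ∀ {n} → Bits n → ℕ → ℕ → Bits n → Bool
meets u i j x = (common u x ≡ᵇ i) ∧ (common (u ⊕ 𝟏) x ≡ᵇ j)

T-meets : ∀ {n} (u x : Bits n) i j → T (meets u i j x) ⇔ (common u x ≡ i × common (u ⊕ 𝟏) x ≡ j)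
T-meets u x i j = mk⇔
  (λ m → let a≡i , b≡j = to T-∧ m in ≡ᵇ⇒≡ _ _ a≡i , ≡ᵇ⇒≡ _ _ b≡j)
  (λ (a≡i , b≡j) → from T-∧ (≡⇒≡ᵇ _ _ a≡i , ≡⇒≡ᵇ _ _ b≡j))

count-meets : ∀ {n} (u : Bits n) i j → countᵇ (meets u i j) (allBits n) ≡ (wt u C i) * (wt (u ⊕ 𝟏) C j)
count-meets [] zero zero = refl
count-meets [] zero (suc j) = refl
count-meets [] (suc i) j = refl
count-meets {suc n} (true ∷ u) zero j = begin
  countᵇ (meets (true ∷ u) zero j) (allBits (suc n))
    ≡⟨ countᵇ-allBits-suc (meets (true ∷ u) zero j) ⟩
  countᵇ (meets u zero j) (allBits n) + countᵇ (λ _ → false) (allBits n)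
    ≡⟨ cong₂ _+_ (count-meets u zero j) (countᵇ-none (λ _ → refl) (allBits n)) ⟩
  1 * (wt (u ⊕ 𝟏) C j) + 0
    ≡⟨ +-identityʳ _ ⟩
  1 * (wt (u ⊕ 𝟏) C j) ∎
  where open ≡-Reasoning
count-meets {suc n} (true ∷ u) (suc i) j = begin
  countᵇ (meets (true ∷ u) (suc i) j) (allBits (suc n))
    ≡⟨ countᵇ-allBits-suc (meets (true ∷ u) (suc i) j) ⟩
  countᵇ (meets u (suc i) j) (allBits n) + countᵇ (meets u i j) (allBits n)
    ≡⟨ cong₂ _+_ (count-meets u (suc i) j) (count-meets u i j) ⟩
  (wt u C suc i) * W + (wt u C i) * W
    ≡⟨ +-comm ((wt u C suc i) * W) _ ⟩
  (wt u C i) * W + (wt u C suc i) * W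
    ≡⟨ *-distribʳ-+ W (wt u C i) (wt u C suc i) ⟨
  (wt u C i + wt u C suc i) * W
    ≡⟨ cong (_* W) (nCk+nC[k+1]≡[n+1]C[k+1] (wt u) i) ⟩
  (suc (wt u) C suc i) * W ∎
  where
  open ≡-Reasoning
  W = wt (u ⊕ 𝟏) C j
count-meets {suc n} (false ∷ u) i zero = begin
  countᵇ (meets (false ∷ u) i zero) (allBits (suc n))
    ≡⟨ countᵇ-allBits-suc (meets (false ∷ u) i zero) ⟩
  countᵇ (meets u i zero) (allBits n) + countᵇ (λ x → (common u x ≡ᵇ i) ∧ false) (allBits n)
    ≡⟨ cong₂ _+_ (count-meets u i zero) (countᵇ-none (λ _ → ∧-zeroʳ _) (allBits n)) ⟩
  (wt u C i) * 1 + 0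
    ≡⟨ +-identityʳ _ ⟩
  (wt u C i) * 1 ∎
  where open ≡-Reasoning
count-meets {suc n} (false ∷ u) i (suc j) = begin
  countᵇ (meets (false ∷ u) i (suc j)) (allBits (suc n))
    ≡⟨ countᵇ-allBits-suc (meets (false ∷ u) i (suc j)) ⟩
  countᵇ (meets u i (suc j)) (allBits n) + countᵇ (meets u i j) (allBits n)
    ≡⟨ cong₂ _+_ (count-meets u i (suc j)) (count-meets u i j) ⟩
  U * (W C suc j) + U * (W C j)
    ≡⟨ +-comm (U * (W C suc j)) _ ⟩
  U * (W C j) + U * (W C suc j)
    ≡⟨ *-distribˡ-+ U (W C j) (W C suc j) ⟨
  U * (W C j + W C suc j)
    ≡⟨ cong (U *_) (nCk+nC[k+1]≡[n+1]C[k+1] W j) ⟩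
  U * (suc W C suc j) ∎
  where
  open ≡-Reasoning
  U = wt u C i
  W = wt (u ⊕ 𝟏)

m+n≡2k∧m≡k⇒n≡k : ∀ {m n k} → m + n ≡ 2 * k → m ≡ k → n ≡ k
m+n≡2k∧m≡k⇒n≡k {k = k} m+n≡2k refl = +-cancelˡ-≡ k _ k (trans m+n≡2k (cong (k +_) (+-identityʳ k)))

adjQ⇔dist≡k : ∀ k (u x : Bits (2 * k)) → T (adjQ k u x) ⇔ dist u x ≡ k
adjQ⇔dist≡k k u x = mk⇔ adjacent (λ d≡k → from T-∨ (inj₁ (≡⇒≡ᵇ _ _ d≡k)))
  where
  via-complement : dist u (x ⊕ 𝟏) ≡ k → dist u x ≡ k
  via-complement = m+n≡2k∧m≡k⇒n≡k (dist-complementʳ u x)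
  adjacent : T (adjQ k u x) → dist u x ≡ k
  adjacent t with to T-∨ t
  ... | inj₁ d = ≡ᵇ⇒≡ _ _ d
  ... | inj₂ t′ with to T-∨ t′
  ... | inj₁ d = via-complement (≡ᵇ⇒≡ _ _ d)
  ... | inj₂ t″ with to T-∨ t″
  ... | inj₁ d = via-complement (trans (sym (dist-complementˡ u x)) (≡ᵇ⇒≡ _ _ d))
  ... | inj₂ d = trans (sym (dist-complement-both u x)) (≡ᵇ⇒≡ _ _ d)

canonical⇒wt≤k : ∀ k (x : Bits (2 * k)) → T (canonical k x) → wt x ≤ k
canonical⇒wt≤k k x c with to T-∨ c
... | inj₁ w<k = <⇒≤ (<ᵇ⇒< _ _ w<k)
... | inj₂ w≡k = ≤-reflexive (≡ᵇ⇒≡ _ _ (proj₁ (to T-∧ w≡k)))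

classWt-≤ : ∀ k (x : Bits (2 * k)) → wt x ≤ k → classWt k x ≡ wt x
classWt-≤ k x w≤k = m≤n⇒m⊓n≡m (m+n≤o⇒m≤o∸n (wt x) (subst (wt x + wt x ≤_) k+k≡2k (+-mono-≤ w≤k w≤k)))
  where
  k+k≡2k : k + k ≡ 2 * k
  k+k≡2k = cong (k +_) (sym (+-identityʳ k))

canonical-classWt⇔wt : ∀ s (x : Bits (2 * suc s)) →
  (T (canonical (suc s) x) × classWt (suc s) x ≡ s) ⇔ wt x ≡ s
canonical-classWt⇔wt s x = mk⇔
  (λ (c , cw) → trans (sym (classWt-≤ (suc s) x (canonical⇒wt≤k (suc s) x c))) cw)
  (λ w≡s → from T-∨ (inj₁ (<⇒<ᵇ (s≤s (≤-reflexive w≡s))))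
         , trans (classWt-≤ (suc s) x (m≤n⇒m≤1+n (≤-reflexive w≡s))) w≡s)

overlaps-determined : ∀ {a b p j t s} → a + p ≡ suc (2 * j) → s ≡ j + t →
  (a + b ≡ s × p + b ≡ suc s) ⇔ (a ≡ j × b ≡ t)
overlaps-determined {a} {b} {p} {j} {t} {s} a+p≡2j+1 s≡j+t = mk⇔ solve check
  where
  a+1+a≡2a+1 : ∀ a → a + suc a ≡ suc (2 * a)
  a+1+a≡2a+1 = solve-∀
  solve : a + b ≡ s × p + b ≡ suc s → a ≡ j × b ≡ t
  solve (a+b≡s , p+b≡1+s) = a≡j , +-cancelˡ-≡ j b t (trans (cong (_+ b) (sym a≡j)) (trans a+b≡s s≡j+t))
    where
    p≡1+a : p ≡ suc a
    p≡1+a = +-cancelʳ-≡ b p (suc a) (trans p+b≡1+s (cong suc (sym a+b≡s)))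
    a≡j : a ≡ j
    a≡j = *-cancelˡ-≡ a j 2 (suc-injective (begin
      suc (2 * a) ≡⟨ a+1+a≡2a+1 a ⟨
      a + suc a   ≡⟨ cong (a +_) p≡1+a ⟨
      a + p       ≡⟨ a+p≡2j+1 ⟩
      suc (2 * j) ∎))
      where open ≡-Reasoning
  check : a ≡ j × b ≡ t → a + b ≡ s × p + b ≡ suc s
  check (refl , refl) = sym s≡j+t , trans (cong (_+ b) p≡1+a) (cong suc (sym s≡j+t))
    where
    p≡1+a : p ≡ suc a
    p≡1+a = +-cancelˡ-≡ a p (suc a) (trans a+p≡2j+1 (sym (a+1+a≡2a+1 a)))

wt-complement-odd : ∀ {s} j t (u : Bits (2 * suc s)) → wt u ≡ suc (2 * j) → s ≡ j + t →
  wt (u ⊕ 𝟏) ≡ suc (2 * t)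
wt-complement-odd {s} j t u wu≡2j+1 s≡j+t = +-cancelʳ-≡ (wt u) (wt (u ⊕ 𝟏)) (suc (2 * t)) (begin
  wt (u ⊕ 𝟏) + wt u         ≡⟨ wt-complement u ⟩
  2 * suc s                 ≡⟨ cong (λ s → 2 * suc s) s≡j+t ⟩
  2 * suc (j + t)           ≡⟨ odd-halves j t ⟩
  suc (2 * t) + suc (2 * j) ≡⟨ cong (suc (2 * t) +_) wu≡2j+1 ⟨
  suc (2 * t) + wt u        ∎)
  where
  open ≡-Reasoning
  odd-halves : ∀ j t → 2 * suc (j + t) ≡ suc (2 * t) + suc (2 * j)
  odd-halves = solve-∀

neighbour⇔meets : ∀ {s} j t (u x : Bits (2 * suc s)) → wt u ≡ suc (2 * j) → s ≡ j + t →
  T (canonical (suc s) x ∧ (classWt (suc s) x ≡ᵇ s) ∧ adjQ (suc s) u x) ⇔ T (meets u j t x)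
neighbour⇔meets {s} j t u x wu≡2j+1 s≡j+t = mk⇔ forward backward
  where
  a = common u x
  b = common (u ⊕ 𝟏) x
  p = common u (x ⊕ 𝟏)
  a+p≡2j+1 : a + p ≡ suc (2 * j)
  a+p≡2j+1 = trans (cong₂ _+_ (common-comm u x) (common-comm u (x ⊕ 𝟏)))
                   (trans (sym (wt-common x u)) wu≡2j+1)
  overlaps⇔ : (a + b ≡ s × p + b ≡ suc s) ⇔ (a ≡ j × b ≡ t)
  overlaps⇔ = overlaps-determined a+p≡2j+1 s≡j+t
  forward : T (canonical (suc s) x ∧ (classWt (suc s) x ≡ᵇ s) ∧ adjQ (suc s) u x) → T (meets u j t x)
  forward q =
    let c , rest = to T-∧ q
        cw , adj = to T-∧ rest
        wx≡s = to (canonical-classWt⇔wt s x) (c , ≡ᵇ⇒≡ _ _ cw)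
        dx≡1+s = to (adjQ⇔dist≡k (suc s) u x) adj
    in from (T-meets u x j t)
            (to overlaps⇔ (trans (sym (wt-common u x)) wx≡s , trans (sym (dist-common u x)) dx≡1+s))
  backward : T (meets u j t x) → T (canonical (suc s) x ∧ (classWt (suc s) x ≡ᵇ s) ∧ adjQ (suc s) u x)
  backward m =
    let a+b≡s , p+b≡1+s = from overlaps⇔ (to (T-meets u x j t) m)
        c , cw = from (canonical-classWt⇔wt s x) (trans (wt-common u x) a+b≡s)
        adj = from (adjQ⇔dist≡k (suc s) u x) (trans (dist-common u x) p+b≡1+s)
    in from T-∧ (c , from T-∧ (≡⇒≡ᵇ _ _ cw , adj))

nbrsOfWt-oddWt : ∀ {s} j t (u : Bits (2 * suc s)) → wt u ≡ suc (2 * j) → s ≡ j + t →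
  nbrsOfWt (suc s) u s ≡ oddCentral j * oddCentral t
nbrsOfWt-oddWt {s} j t u wu≡2j+1 s≡j+t = begin
  nbrsOfWt (suc s) u s
    ≡⟨ countᵇ-cong (λ x → neighbour⇔meets j t u x wu≡2j+1 s≡j+t) (allBits (2 * suc s)) ⟩
  countᵇ (meets u j t) (allBits (2 * suc s))
    ≡⟨ count-meets u j t ⟩
  (wt u C j) * (wt (u ⊕ 𝟏) C t)
    ≡⟨ cong₂ (λ m n → (m C j) * (n C t)) wu≡2j+1 (wt-complement-odd j t u wu≡2j+1 s≡j+t) ⟩
  oddCentral j * oddCentral t ∎
  where open ≡-Reasoning

classWt-attained : ∀ k (u : Bits (2 * k)) → classWt k u ≡ wt u ⊎ classWt k u ≡ wt (u ⊕ 𝟏)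
classWt-attained k u = Sum.map₂ (λ c≡wū → trans c≡wū (sym (wt-complement-∸ u))) (⊓-sel (wt u) (2 * k ∸ wt u))

nbrsOfWt-oddClassWt : ∀ {s} j (u : Bits (2 * suc s)) → classWt (suc s) u ≡ suc (2 * j) → j ≤ s →
  nbrsOfWt (suc s) u s ≡ oddCentral j * oddCentral (s ∸ j)
nbrsOfWt-oddClassWt {s} j u cu≡2j+1 j≤s = [ light , heavy ]′ (classWt-attained (suc s) u)
  where
  t = s ∸ j
  s≡j+t : s ≡ j + t
  s≡j+t = sym (m+[n∸m]≡n j≤s)
  light : classWt (suc s) u ≡ wt u → nbrsOfWt (suc s) u s ≡ oddCentral j * oddCentral t
  light c≡wu = nbrsOfWt-oddWt j t u (trans (sym c≡wu) cu≡2j+1) s≡j+t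
  heavy : classWt (suc s) u ≡ wt (u ⊕ 𝟏) → nbrsOfWt (suc s) u s ≡ oddCentral j * oddCentral t
  heavy c≡wū = trans (nbrsOfWt-oddWt t j u wu≡2t+1 (trans s≡j+t (+-comm j t)))
                     (*-comm (oddCentral t) (oddCentral j))
    where
    wu≡2t+1 : wt u ≡ suc (2 * t)
    wu≡2t+1 = trans (cong wt (sym (complement-involutive u)))
                    (wt-complement-odd j t (u ⊕ 𝟏) (trans (sym c≡wū) cu≡2j+1) s≡j+t)

corollary2 : (k m n : ℕ) → 1 ≤ k → Odd m → Odd n → m ≢ n → m ≤ k → n ≤ k →
    (u x : Bits (2 * k)) → classWt k u ≡ m → classWt k x ≡ n →
    nbrsOfWt k u (k ∸ 1) ≢ nbrsOfWt k x (k ∸ 1)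
corollary2 (suc s) _ _ _ (j₁ , refl) (j₂ , refl) m≢n (s≤s 2j₁≤s) (s≤s 2j₂≤s) u x cu cx same =
  m≢n (cong (λ j → suc (2 * j)) (oddCentral-balanced-injective {s} {j₁} {j₂} 2j₁≤s 2j₂≤s (begin
    oddCentral j₁ * oddCentral (s ∸ j₁) ≡⟨ nbrsOfWt-oddClassWt j₁ u cu (2*j≤s⇒j≤s 2j₁≤s) ⟨
    nbrsOfWt (suc s) u s                 ≡⟨ same ⟩
    nbrsOfWt (suc s) x s                 ≡⟨ nbrsOfWt-oddClassWt j₂ x cx (2*j≤s⇒j≤s 2j₂≤s) ⟩
    oddCentral j₂ * oddCentral (s ∸ j₂) ∎)))
  where open ≡-Reasoning
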